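{- Let $\mathbf M$ be a cyclic pointed residuated $\mathbf S$-bimodule with point $0$, and let $\gamma\langle a,x\rangle=\langle 0\backslash_r x,x\rangle$ on $S\times M$. The map $e_M:M\to\gamma[S\times M]$, $e_M(x)=\langle 0\backslash_r x,x\rangle$ $(=\langle x/_\ell 0,x\rangle)$, is an isomorphism of posets (with the componentwise order on $S\times M$). In particular, as a map $e_M:M\to(\mathbf S\ltimes\mathbf M)_0$ it preserves all existing meets in $(\mathbf S\ltimes\mathbf M)_0$.
   Context: $\mathbf S$ is a posemigroup (poset with isotone associative multiplication), $\mathbf M=\langle M,\vee\rangle$ a join semilattice; elements of $S$ are $a,b$, of $M$ are $x,y$. A residuated $\mathbf S$-bimodule: isotone actions $a*x,x*a\in M$ with $(ab)*x=a*(b*x)$, $x*(ab)=(x*a)*b$, $(a*x)*b=a*(x*b)$, distributing over $\vee$, and maps $\backslash_\ell:S\times M\to M$, $/_\ell:M\times M\to S$, $\backslash_r:M\times M\to S$, $/_r:M\times S\to M$ with $x\le a\backslash_\ell y\iff a*x\le y\iff a\le y/_\ell x$ and $x\le y/_r a\iff x*a\le y\iff a\le x\backslash_r y$. Cyclic pointed: $0\in M$ with $a*0=0*a$ for all $a$. The restricted Nagata product $(\mathbf S\ltimes\mathbf M)_0$ is the set $\{\langle a,x\rangle\in S\times M:0*a\le x,a*0\le x\}$ with componentwise order (and multiplication $\langle a,x\rangle\circ\langle b,y\rangle=\langle ab,x*b\vee a*y\rangle$). -}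

module Defs where

open import Level using (Level; _⊔_; suc)
open import Data.Product using (Σ; _×_; _,_; proj₁; proj₂)
open import Relation.Binary.Bundles using (Poset)
open import Relation.Binary.Lattice.Bundles using (JoinSemilattice)

record Posemigroup c ℓ₁ ℓ₂ : Set (suc (c ⊔ ℓ₁ ⊔ ℓ₂)) where
  field
    poset : Poset c ℓ₁ ℓ₂
  open Poset poset public
  infixl 7 _·_
  field
    _·_    : Carrier → Carrier → Carrier
    ·-mono : ∀ {a a′ b b′} → a ≤ a′ → b ≤ b′ → a · b ≤ a′ · b′
    ·-assoc : ∀ a b c → (a · b) · c ≈ a · (b · c)

record ResiduatedBimodule {c₁ ℓ₁ ℓ₂ c₂ ℓ₃ ℓ₄}
    (S : Posemigroup c₁ ℓ₁ ℓ₂) (M : JoinSemilattice c₂ ℓ₃ ℓ₄)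
    : Set (c₁ ⊔ ℓ₁ ⊔ ℓ₂ ⊔ c₂ ⊔ ℓ₃ ⊔ ℓ₄) where
  private
    module S = Posemigroup S
    module M = JoinSemilattice M
  field
    _*ₗ_ : S.Carrier → M.Carrier → M.Carrier
    _*ᵣ_ : M.Carrier → S.Carrier → M.Carrier
    *ₗ-mono : ∀ {a b x y} → a S.≤ b → x M.≤ y → (a *ₗ x) M.≤ (b *ₗ y)
    *ᵣ-mono : ∀ {a b x y} → a S.≤ b → x M.≤ y → (x *ᵣ a) M.≤ (y *ᵣ b)
    *ₗ-assoc : ∀ a b x → ((a S.· b) *ₗ x) M.≈ (a *ₗ (b *ₗ x))
    *ᵣ-assoc : ∀ x a b → (x *ᵣ (a S.· b)) M.≈ ((x *ᵣ a) *ᵣ b)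
    *-bimod  : ∀ a x b → ((a *ₗ x) *ᵣ b) M.≈ (a *ₗ (x *ᵣ b))
    *ₗ-distrib-∨ : ∀ a x y → (a *ₗ (x M.∨ y)) M.≈ ((a *ₗ x) M.∨ (a *ₗ y))
    *ᵣ-distrib-∨ : ∀ x y a → ((x M.∨ y) *ᵣ a) M.≈ ((x *ᵣ a) M.∨ (y *ᵣ a))
    _⧵ₗ_ : S.Carrier → M.Carrier → M.Carrier
    _/ₗ_ : M.Carrier → M.Carrier → S.Carrier
    _⧵ᵣ_ : M.Carrier → M.Carrier → S.Carrier
    _/ᵣ_ : M.Carrier → S.Carrier → M.Carrier
    resₗ₁ : ∀ a x y → x M.≤ (a ⧵ₗ y) → (a *ₗ x) M.≤ y
    resₗ₂ : ∀ a x y → (a *ₗ x) M.≤ y → x M.≤ (a ⧵ₗ y)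
    resₗ₃ : ∀ a x y → (a *ₗ x) M.≤ y → a S.≤ (y /ₗ x)
    resₗ₄ : ∀ a x y → a S.≤ (y /ₗ x) → (a *ₗ x) M.≤ y
    resᵣ₁ : ∀ a x y → x M.≤ (y /ᵣ a) → (x *ᵣ a) M.≤ y
    resᵣ₂ : ∀ a x y → (x *ᵣ a) M.≤ y → x M.≤ (y /ᵣ a)
    resᵣ₃ : ∀ a x y → (x *ᵣ a) M.≤ y → a S.≤ (x ⧵ᵣ y)
    resᵣ₄ : ∀ a x y → a S.≤ (x ⧵ᵣ y) → (x *ᵣ a) M.≤ y

record CyclicPointed {c₁ ℓ₁ ℓ₂ c₂ ℓ₃ ℓ₄}
    {S : Posemigroup c₁ ℓ₁ ℓ₂} {M : JoinSemilattice c₂ ℓ₃ ℓ₄}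
    (B : ResiduatedBimodule S M) : Set (c₁ ⊔ c₂ ⊔ ℓ₃) where
  open ResiduatedBimodule B
  private
    module S = Posemigroup S
    module M = JoinSemilattice M
  field
    point  : M.Carrier
    cyclic : ∀ a → (a *ₗ point) M.≈ (point *ᵣ a)

module NagataNotions {c₁ ℓ₁ ℓ₂ c₂ ℓ₃ ℓ₄}
    {S : Posemigroup c₁ ℓ₁ ℓ₂} {M : JoinSemilattice c₂ ℓ₃ ℓ₄}
    {B : ResiduatedBimodule S M} (P : CyclicPointed B) where
  open ResiduatedBimodule B
  open CyclicPointed P
  private
    module S = Posemigroup S
    module M = JoinSemilattice M

  SM : Set (c₁ ⊔ c₂)
  SM = S.Carrier × M.Carrier

  _≤SM_ : SM → SM → Set (ℓ₂ ⊔ ℓ₄)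
  (a , x) ≤SM (b , y) = (a S.≤ b) × (x M.≤ y)

  _≈SM_ : SM → SM → Set (ℓ₁ ⊔ ℓ₃)
  (a , x) ≈SM (b , y) = (a S.≈ b) × (x M.≈ y)

  γ : SM → SM
  γ (a , x) = (point ⧵ᵣ x) , x

  InImageγ : SM → Set (c₁ ⊔ c₂ ⊔ ℓ₁ ⊔ ℓ₃)
  InImageγ p = Σ SM λ q → γ q ≈SM p

  eM : M.Carrier → SM
  eM x = (point ⧵ᵣ x) , x

  -- membership in the restricted Nagata product (S ⋉ M)₀
  InRestricted : SM → Set ℓ₄
  InRestricted (a , x) = ((point *ᵣ a) M.≤ x) × ((a *ₗ point) M.≤ x)

  IsMeetM : ∀ {ι} {I : Set ι} → (I → M.Carrier) → M.Carrier → Set (ι ⊔ c₂ ⊔ ℓ₄)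
  IsMeetM {I = I} f m =
    (∀ i → m M.≤ f i) × (∀ z → (∀ i → z M.≤ f i) → z M.≤ m)

  IsMeet₀ : ∀ {ι} {I : Set ι} → (I → SM) → SM → Set (ι ⊔ c₁ ⊔ c₂ ⊔ ℓ₂ ⊔ ℓ₄)
  IsMeet₀ {I = I} f m =
    InRestricted m × (∀ i → m ≤SM f i)
      × (∀ q → InRestricted q → (∀ i → q ≤SM f i) → q ≤SM m)

{-# OPTIONS --safe #-}
module Submission where

open import Defs
open import Level using (Level)
open import Data.Product using (Σ; _×_; _,_; proj₁; proj₂)
open import Relation.Binary.Lattice.Bundles using (JoinSemilattice)

-- γ ignores its S-coordinate, so γ[S × M] is the graph of x ↦ 0 ⧵ᵣ x and eM is
-- onto it; that graph is ordered by its M-coordinate because 0 ⧵ᵣ _ is isotone.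
-- Cyclicity a * 0 = 0 * a makes 0 ⧵ᵣ x and x /ₗ 0 both the largest a with
-- 0 * a ≤ x. If ⟨a, z⟩ ∈ (S ⋉ M)₀ lies below every eM (f i), then z ≤ m = ⋀ f,
-- so 0 * a ≤ z ≤ m, i.e. a ≤ 0 ⧵ᵣ m: the meet of the eM (f i) is eM m.

module Residuation {c₁ ℓ₁ ℓ₂ c₂ ℓ₃ ℓ₄ : Level}
    {S : Posemigroup c₁ ℓ₁ ℓ₂} {M : JoinSemilattice c₂ ℓ₃ ℓ₄}
    (B : ResiduatedBimodule S M) where
  open ResiduatedBimodule B
  private
    module S = Posemigroup S
    module M = JoinSemilattice M

  *ᵣ-⧵ᵣ-counit : ∀ x y → (x *ᵣ (x ⧵ᵣ y)) M.≤ y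
  *ᵣ-⧵ᵣ-counit x y = resᵣ₄ _ x y S.refl

  /ₗ-*ₗ-counit : ∀ x y → ((y /ₗ x) *ₗ x) M.≤ y
  /ₗ-*ₗ-counit x y = resₗ₄ _ x y S.refl

  ⧵ᵣ-monoʳ : ∀ x {y y′} → y M.≤ y′ → (x ⧵ᵣ y) S.≤ (x ⧵ᵣ y′)
  ⧵ᵣ-monoʳ x {y} {y′} y≤y′ = resᵣ₃ _ x y′ (M.trans (*ᵣ-⧵ᵣ-counit x y) y≤y′)

module Embedding {c₁ ℓ₁ ℓ₂ c₂ ℓ₃ ℓ₄ : Level}
    {S : Posemigroup c₁ ℓ₁ ℓ₂} {M : JoinSemilattice c₂ ℓ₃ ℓ₄}
    {B : ResiduatedBimodule S M} (P : CyclicPointed B) where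
  open NagataNotions P
  open ResiduatedBimodule B
  open CyclicPointed P
  open Residuation B
  private
    module S = Posemigroup S
    module M = JoinSemilattice M

  point⧵ᵣ≈/ₗpoint : ∀ x → (point ⧵ᵣ x) S.≈ (x /ₗ point)
  point⧵ᵣ≈/ₗpoint x = S.antisym
    (resₗ₃ _ point x (M.≤-respˡ-≈ (M.Eq.sym (cyclic _)) (*ᵣ-⧵ᵣ-counit point x)))
    (resᵣ₃ _ point x (M.≤-respˡ-≈ (cyclic _) (/ₗ-*ₗ-counit point x)))

  eM≈⟨/ₗpoint⟩ : ∀ x → eM x ≈SM ((x /ₗ point) , x)
  eM≈⟨/ₗpoint⟩ x = point⧵ᵣ≈/ₗpoint x , M.Eq.refl

  eM∈Imageγ : ∀ x → InImageγ (eM x)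
  eM∈Imageγ x = eM x , S.Eq.refl , M.Eq.refl

  Imageγ⊆image-eM : ∀ p → InImageγ p → Σ M.Carrier λ x → eM x ≈SM p
  Imageγ⊆image-eM p ((_ , x) , γ≈p) = x , γ≈p

  eM-mono : ∀ x y → x M.≤ y → eM x ≤SM eM y
  eM-mono x y x≤y = ⧵ᵣ-monoʳ point x≤y , x≤y

  eM-reflects-≤ : ∀ x y → eM x ≤SM eM y → x M.≤ y
  eM-reflects-≤ _ _ = proj₂

  eM∈Restricted : ∀ x → InRestricted (eM x)
  eM∈Restricted x = *ᵣ-⧵ᵣ-counit point x
    , M.≤-respˡ-≈ (M.Eq.sym (cyclic _)) (*ᵣ-⧵ᵣ-counit point x)

  eM-preserves-meets : ∀ {ι} (I : Set ι) (f : I → M.Carrier) m → IsMeetM f m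
    → IsMeet₀ (λ i → eM (f i)) (eM m)
  eM-preserves-meets I f m (m≤f , greatest) =
    eM∈Restricted m , (λ i → eM-mono m (f i) (m≤f i)) , below-eM-m
    where
    below-eM-m : ∀ q → InRestricted q → (∀ i → q ≤SM eM (f i)) → q ≤SM eM m
    below-eM-m (a , z) (point*a≤z , _) q≤ef =
      resᵣ₃ a point m (M.trans point*a≤z z≤m) , z≤m
      where
      z≤m : z M.≤ m
      z≤m = greatest z (λ i → proj₂ (q≤ef i))

mainTheorem9 : ∀ {c₁ ℓ₁ ℓ₂ c₂ ℓ₃ ℓ₄ ι : Level}
    {S : Posemigroup c₁ ℓ₁ ℓ₂} {M : JoinSemilattice c₂ ℓ₃ ℓ₄}
    {B : ResiduatedBimodule S M} (P : CyclicPointed B) →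
    let open NagataNotions P
        open ResiduatedBimodule B
        open CyclicPointed P
    in (∀ x → InImageγ (eM x))
       × (∀ x → eM x ≈SM ((x /ₗ point) , x))
       × (∀ x y → JoinSemilattice._≤_ M x y → eM x ≤SM eM y)
       × (∀ x y → eM x ≤SM eM y → JoinSemilattice._≤_ M x y)
       × (∀ p → InImageγ p → Σ _ λ x → eM x ≈SM p)
       × (∀ x → InRestricted (eM x))
       × (∀ (I : Set ι) (f : I → _) m → IsMeetM f m
            → IsMeet₀ (λ i → eM (f i)) (eM m))
mainTheorem9 P =
  eM∈Imageγ , eM≈⟨/ₗpoint⟩ , eM-mono , eM-reflects-≤ , Imageγ⊆image-eM
  , eM∈Restricted , eM-preserves-meets
  where open Embedding P
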